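{- For all integers $p,q\geq 3$, the Cartesian product $C_p\square P_q$ of the cycle on $p$ vertices and the path on $q$ vertices does not have the PMH--property.
   Context: $C_n$ denotes the cycle graph and $P_n$ the path graph on $n$ vertices. The Cartesian product $G\square H$ of graphs $G$ and $H$ has vertex set $V(G)\times V(H)$, with $(u,v)$ adjacent to $(u',v')$ iff either $u=u'$ and $vv'\in E(H)$, or $uu'\in E(G)$ and $v=v'$. A perfect matching $M$ of a graph $G$ can be extended to a Hamiltonian cycle if there is a perfect matching $N$ of $G$ such that $M\cup N$ is a Hamiltonian cycle of $G$. A graph has the PMH--property if it admits a perfect matching and every one of its perfect matchings can be extended to a Hamiltonian cycle; a graph with no perfect matching does not have the PMH--property. -}

module Defs where

open import Data.Nat using (ℕ; zero; suc; _+_; _*_; _≤_; NonZero; s≤s; z≤n; >-nonZero)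
open import Data.Nat.Properties using (≤-trans)
open import Data.Nat.DivMod using (_%_)
open import Data.Fin using (Fin; toℕ; fromℕ<)
open import Data.Nat.DivMod using (m%n<n)
open import Data.Product using (Σ; _×_; _,_; ∃)
open import Data.Sum using (_⊎_)
open import Function.Bundles using (_⇔_; _↔_; Inverse)
open import Relation.Binary.PropositionalEquality using (_≡_)

-- A graph on vertex set V, given by its adjacency relation.  (For the
-- graphs used here, C_p □ P_q with p ≥ 3, it is symmetric and irreflexive.)
Graph : Set → Set₁
Graph V = V → V → Set

record PerfectMatching {V : Set} (G : Graph V) : Set₁ where
  field
    E       : V → V → Set
    E-sym   : ∀ {u v} → E u v → E v u
    E-edge  : ∀ {u v} → E u v → G u v
    partner : V → V
    covers  : ∀ v → E v (partner v)
    unique  : ∀ {v w} → E v w → w ≡ partner v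

open PerfectMatching public

sucMod : (n : ℕ) → .{{_ : NonZero n}} → Fin n → Fin n
sucMod n i = fromℕ< (m%n<n (suc (toℕ i)) n)

-- A Hamiltonian cycle of a graph G on vertex set V with |V| = k ≥ 3:
-- a cyclic enumeration c(0), ..., c(k-1) of all vertices (c a bijection
-- Fin k ↔ V) with c(i) adjacent to c(i+1 mod k).
record HamCycle {V : Set} (G : Graph V) : Set where
  field
    k      : ℕ
    k≥3    : 3 ≤ k
    c      : Fin k ↔ V
  instance
    k-nz : NonZero k
    k-nz = >-nonZero (≤-trans (s≤s z≤n) k≥3)
  open Inverse c using (to) public
  field
    consec : ∀ i → G (to i) (to (sucMod k i))

  Edge : V → V → Set
  Edge u v = ∃ λ i → (u ≡ to i × v ≡ to (sucMod k i))
                   ⊎ (v ≡ to i × u ≡ to (sucMod k i))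

Extendable : {V : Set} (G : Graph V) → PerfectMatching G → Set₁
Extendable G M = Σ (PerfectMatching G) λ N → Σ (HamCycle G) λ H →
  ∀ u v → (E M u v ⊎ E N u v) ⇔ HamCycle.Edge H u v

PMH : {V : Set} → Graph V → Set₁
PMH G = PerfectMatching G × (∀ (M : PerfectMatching G) → Extendable G M)

CPAdj : (p q : ℕ) → .{{_ : NonZero p}} → Fin p × Fin q → Fin p × Fin q → Set
CPAdj p q (a , b) (a' , b') =
    (a ≡ a' × (toℕ b' ≡ suc (toℕ b) ⊎ toℕ b ≡ suc (toℕ b')))
  ⊎ ((a' ≡ sucMod p a ⊎ a ≡ sucMod p a') × b ≡ b')

CpPq : (p q : ℕ) → .{{_ : NonZero p}} → Graph (Fin p × Fin q)
CpPq p q = CPAdj p q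

-- A Hamiltonian cycle made of two perfect matchings M and N alternates between them, so
-- every vertex set closed under both M and N is everything, and M restricted to the cycle
-- is a perfect matching of the cycle, forcing an even number of vertices.  If p and q are
-- odd this already rules out the PMH-property.  If p is even, match row 1 by the pairs
-- {2j+1, 2j+2} of C_p and all other rows by {2j, 2j+1}: row 0 together with those (a , 1)
-- that N matches straight down is closed under both matchings, so the cycle never reaches
-- row 2.  If p is odd and q even, match every column vertically: N must then match row 0
-- within itself, i.e. perfectly match the odd cycle C_p.
module Submission where

open import Defs
open import Data.Nat using (ℕ; _≤_; NonZero)
open import Relation.Nullary using (¬_; contradiction)

open import Data.Nat.Base using (zero; suc; _+_; _*_; _<_; s≤s; >-nonZero⁻¹)
import Data.Nat.Properties as ℕ
open import Data.Nat.DivMod using (_%_; m<n⇒m%n≡m; n%n≡0)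
open import Data.Fin.Base as Fin using (Fin; toℕ; fromℕ<; fromℕ; inject₁)
open import Data.Fin.Patterns using (0F; 1F; 2F)
import Data.Fin.Properties as Fin
open import Data.Fin.Permutation using (↔⇒≡)
open import Data.Bool.Base using (Bool; true; false; not; _xor_; _∨_)
open import Data.Bool.Properties using (not-¬; not-involutive; not-distribˡ-xor; not-distribʳ-xor)
open import Data.Product.Base using (_×_; _,_; proj₁; proj₂; ∃-syntax)
open import Data.Sum.Base using (_⊎_; inj₁; inj₂)
open import Data.Empty using (⊥)
open import Data.Unit.Base using (⊤; tt)
open import Function.Bundles using (Inverse; _↔_; _⇔_; Equivalence)
open import Function.Properties.Inverse using (↔-sym; ↔-trans)
open import Relation.Binary.PropositionalEquality

inner⊎last : ∀ {n} (i : Fin n) → suc (toℕ i) < n ⊎ suc (toℕ i) ≡ n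
inner⊎last i = ℕ.m≤n⇒m<n∨m≡n (Fin.toℕ<n i)

module _ {n : ℕ} .{{_ : NonZero n}} where

  toℕ-sucMod-inner : (i : Fin n) → suc (toℕ i) < n → toℕ (sucMod n i) ≡ suc (toℕ i)
  toℕ-sucMod-inner i i<n = trans (Fin.toℕ-fromℕ< _) (m<n⇒m%n≡m i<n)

  toℕ-sucMod-last : (i : Fin n) → suc (toℕ i) ≡ n → toℕ (sucMod n i) ≡ 0
  toℕ-sucMod-last i i≡n = trans (Fin.toℕ-fromℕ< _) (trans (cong (_% n) i≡n) (n%n≡0 n))

  sucMod-injective : ∀ {i j : Fin n} → sucMod n i ≡ sucMod n j → i ≡ j
  sucMod-injective {i} {j} e with inner⊎last i | inner⊎last j
  ... | inj₁ hi | inj₁ hj = Fin.toℕ-injective (ℕ.suc-injective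
    (trans (sym (toℕ-sucMod-inner i hi)) (trans (cong toℕ e) (toℕ-sucMod-inner j hj))))
  ... | inj₁ hi | inj₂ hj = contradiction
    (trans (sym (toℕ-sucMod-inner i hi)) (trans (cong toℕ e) (toℕ-sucMod-last j hj))) λ ()
  ... | inj₂ hi | inj₁ hj = contradiction
    (trans (sym (toℕ-sucMod-inner j hj)) (trans (cong toℕ (sym e)) (toℕ-sucMod-last i hi))) λ ()
  ... | inj₂ hi | inj₂ hj = Fin.toℕ-injective (ℕ.suc-injective (trans hi (sym hj)))

  sucMod-fromℕ< : ∀ m (m+1<n : suc m < n) →
                  sucMod n (fromℕ< (ℕ.<-trans (ℕ.n<1+n m) m+1<n)) ≡ fromℕ< m+1<n
  sucMod-fromℕ< m m+1<n = Fin.toℕ-injective (begin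
    toℕ (sucMod n (fromℕ< _)) ≡⟨ toℕ-sucMod-inner _ (subst (λ t → suc t < n) (sym (Fin.toℕ-fromℕ< _)) m+1<n) ⟩
    suc (toℕ (fromℕ< _))      ≡⟨ cong suc (Fin.toℕ-fromℕ< _) ⟩
    suc m                     ≡⟨ Fin.toℕ-fromℕ< m+1<n ⟨
    toℕ (fromℕ< m+1<n)        ∎)
    where open ≡-Reasoning

  sucMod²≢id : 3 ≤ n → (i : Fin n) → sucMod n (sucMod n i) ≢ i
  sucMod²≢id 2<n i e with inner⊎last i | inner⊎last (sucMod n i)
  ... | inj₁ h₁ | inj₁ h₂ = ℕ.m≢1+n+m (toℕ i) {1}
    (trans (cong toℕ (sym e)) (trans (toℕ-sucMod-inner _ h₂) (cong suc (toℕ-sucMod-inner i h₁))))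
  ... | inj₁ h₁ | inj₂ h₂ = ℕ.<⇒≢ 2<n (sym (begin
    n                                       ≡⟨ h₂ ⟨
    suc (toℕ (sucMod n i))                  ≡⟨ cong suc (toℕ-sucMod-inner i h₁) ⟩
    suc (suc (toℕ i))                       ≡⟨ cong (λ j → suc (suc (toℕ j))) e ⟨
    suc (suc (toℕ (sucMod n (sucMod n i)))) ≡⟨ cong (λ t → suc (suc t)) (toℕ-sucMod-last _ h₂) ⟩
    2                                       ∎))
    where open ≡-Reasoning
  ... | inj₂ h₁ | inj₁ h₂ = ℕ.<⇒≢ 2<n (sym (begin
    n                                 ≡⟨ h₁ ⟨
    suc (toℕ i)                       ≡⟨ cong (λ j → suc (toℕ j)) e ⟨
    suc (toℕ (sucMod n (sucMod n i))) ≡⟨ cong suc (toℕ-sucMod-inner _ h₂) ⟩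
    suc (suc (toℕ (sucMod n i)))      ≡⟨ cong (λ t → suc (suc t)) (toℕ-sucMod-last i h₁) ⟩
    2                                 ∎))
    where open ≡-Reasoning
  ... | inj₂ h₁ | inj₂ h₂ = ℕ.<⇒≢ (ℕ.<-trans (ℕ.n<1+n 1) 2<n)
    (trans (cong suc (sym (toℕ-sucMod-last i h₁))) h₂)

predMod : ∀ {n} → Fin n → Fin n
predMod {suc n} Fin.zero    = fromℕ n
predMod {suc n} (Fin.suc i) = inject₁ i

sucMod-predMod : ∀ {n} .{{_ : NonZero n}} (i : Fin n) → sucMod n (predMod i) ≡ i
sucMod-predMod {suc n} Fin.zero =
  Fin.toℕ-injective (toℕ-sucMod-last (fromℕ n) (cong suc (Fin.toℕ-fromℕ n)))
sucMod-predMod {suc n} (Fin.suc i) =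
  Fin.toℕ-injective (trans (toℕ-sucMod-inner (inject₁ i) i+1<n) (cong suc (Fin.toℕ-inject₁ i)))
  where i+1<n : suc (toℕ (inject₁ i)) < suc n
        i+1<n = subst (λ t → suc t < suc n) (sym (Fin.toℕ-inject₁ i)) (Fin.toℕ<n (Fin.suc i))

predMod-sucMod : ∀ {n} .{{_ : NonZero n}} (i : Fin n) → predMod (sucMod n i) ≡ i
predMod-sucMod i = sucMod-injective (sucMod-predMod _)

predMod≢sucMod : ∀ {n} .{{_ : NonZero n}} → 3 ≤ n → (i : Fin n) → predMod i ≢ sucMod n i
predMod≢sucMod {n} 2<n i e =
  sucMod²≢id 2<n (predMod i) (trans (cong (sucMod n) (sucMod-predMod i)) (sym e))

cyclic-transport : ∀ {n} .{{_ : NonZero n}} (P : Fin n → Set) →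
                   (∀ i → P i → P (sucMod n i)) → (∀ i → P (sucMod n i) → P i) →
                   ∀ i j → P i → P j
cyclic-transport {suc n} P forward backward i j pi =
  subst P (Fin.fromℕ<-toℕ j _) (fromZero (toℕ j) (Fin.toℕ<n j)
    (toZero (toℕ i) (Fin.toℕ<n i) (subst P (sym (Fin.fromℕ<-toℕ i _)) pi)))
  where
  toZero : ∀ m (m<n : m < suc n) → P (fromℕ< m<n) → P 0F
  toZero zero    _    p = p
  toZero (suc m) m<n p =
    toZero m (ℕ.<-trans (ℕ.n<1+n m) m<n) (backward _ (subst P (sym (sucMod-fromℕ< m m<n)) p))
  fromZero : ∀ m (m<n : m < suc n) → P 0F → P (fromℕ< m<n)
  fromZero zero    _   p = p
  fromZero (suc m) m<n p =
    subst P (sucMod-fromℕ< m m<n) (forward _ (fromZero m (ℕ.<-trans (ℕ.n<1+n m) m<n) p))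

isEven : ℕ → Bool
isEven zero    = true
isEven (suc n) = not (isEven n)

isEven-+ : ∀ m n → isEven (m + n) ≡ not (isEven m xor isEven n)
isEven-+ zero    n = sym (not-involutive (isEven n))
isEven-+ (suc m) n = cong not (trans (isEven-+ m n) (not-distribˡ-xor (isEven m) (isEven n)))

isEven-* : ∀ m n → isEven (m * n) ≡ isEven m ∨ isEven n
isEven-* zero    n = refl
isEven-* (suc m) n =
  trans (isEven-+ n (m * n)) (trans (cong (λ c → not (isEven n xor c)) (isEven-* m n)) (not-xor-∨ (isEven m) (isEven n)))
  where
  not-xor-∨ : ∀ a b → not (b xor (a ∨ b)) ≡ not a ∨ b
  not-xor-∨ true  true  = refl
  not-xor-∨ true  false = refl
  not-xor-∨ false true  = refl
  not-xor-∨ false false = refl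

module _ {n : ℕ} .{{_ : NonZero n}} (n-even : isEven n ≡ true) where

  isEven-sucMod : (i : Fin n) → isEven (toℕ (sucMod n i)) ≡ not (isEven (toℕ i))
  isEven-sucMod i with inner⊎last i
  ... | inj₁ i+1<n = cong isEven (toℕ-sucMod-inner i i+1<n)
  ... | inj₂ i+1≡n = trans (cong isEven (toℕ-sucMod-last i i+1≡n)) (sym (trans (cong isEven i+1≡n) n-even))

  isEven-predMod : (i : Fin n) → isEven (toℕ (predMod i)) ≡ not (isEven (toℕ i))
  isEven-predMod i = begin
    isEven (toℕ (predMod i))                   ≡⟨ not-involutive _ ⟨
    not (not (isEven (toℕ (predMod i))))       ≡⟨ cong not (isEven-sucMod (predMod i)) ⟨
    not (isEven (toℕ (sucMod n (predMod i))))  ≡⟨ cong (λ j → not (isEven (toℕ j))) (sucMod-predMod i) ⟩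
    not (isEven (toℕ i))                       ∎
    where open ≡-Reasoning

  even⇒inner : (i : Fin n) → isEven (toℕ i) ≡ true → suc (toℕ i) < n
  even⇒inner i i-even with inner⊎last i
  ... | inj₁ i+1<n = i+1<n
  ... | inj₂ i+1≡n = contradiction (trans (sym n-even) (trans (cong isEven (sym i+1≡n)) (cong not i-even))) λ ()

module _ {n : ℕ} .{{_ : NonZero n}} where

  neighbour : Bool → Fin n → Fin n
  neighbour true  = sucMod n
  neighbour false = predMod

  neighbour-adjacent : ∀ c (i : Fin n) → neighbour c i ≡ sucMod n i ⊎ i ≡ sucMod n (neighbour c i)
  neighbour-adjacent true  i = inj₁ refl
  neighbour-adjacent false i = inj₂ (sym (sucMod-predMod i))

  neighbour-not : ∀ c (i : Fin n) → neighbour (not c) (neighbour c i) ≡ i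
  neighbour-not true  = predMod-sucMod
  neighbour-not false = sucMod-predMod

  -- pairing false matches 0–1, 2–3, …; pairing true matches 1–2, 3–4, …, (n-1)–0.
  pairing : Bool → Fin n → Fin n
  pairing b i = neighbour (b xor isEven (toℕ i)) i

  neighbour-is-pairing : ∀ c (i : Fin n) → ∃[ b ] neighbour c i ≡ pairing b i
  neighbour-is-pairing c i with isEven (toℕ i)
  neighbour-is-pairing true  i | true  = false , refl
  neighbour-is-pairing false i | true  = true  , refl
  neighbour-is-pairing true  i | false = true  , refl
  neighbour-is-pairing false i | false = false , refl

  module _ (n-even : isEven n ≡ true) where

    isEven-neighbour : ∀ c (i : Fin n) → isEven (toℕ (neighbour c i)) ≡ not (isEven (toℕ i))
    isEven-neighbour true  = isEven-sucMod n-even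
    isEven-neighbour false = isEven-predMod n-even

    pairing-involutive : ∀ b (i : Fin n) → pairing b (pairing b i) ≡ i
    pairing-involutive b i = begin
      neighbour (b xor isEven (toℕ (neighbour c i))) (neighbour c i)
        ≡⟨ cong (λ e → neighbour (b xor e) (neighbour c i)) (isEven-neighbour c i) ⟩
      neighbour (b xor not (isEven (toℕ i))) (neighbour c i)
        ≡⟨ cong (λ d → neighbour d (neighbour c i)) (not-distribʳ-xor b (isEven (toℕ i))) ⟨
      neighbour (not c) (neighbour c i)
        ≡⟨ neighbour-not c i ⟩
      i ∎
      where open ≡-Reasoning
            c : Bool
            c = b xor isEven (toℕ i)

    toℕ-pairing-false : (i : Fin n) →
      toℕ (pairing false i) ≡ suc (toℕ i) ⊎ toℕ i ≡ suc (toℕ (pairing false i))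
    toℕ-pairing-false i with isEven (toℕ i) in i-even
    ... | true  = inj₁ (toℕ-sucMod-inner i (even⇒inner n-even i i-even))
    ... | false = inj₂ (begin
      toℕ i                         ≡⟨ cong toℕ (sucMod-predMod i) ⟨
      toℕ (sucMod n (predMod i))    ≡⟨ toℕ-sucMod-inner (predMod i) (even⇒inner n-even (predMod i) pred-even) ⟩
      suc (toℕ (predMod i))         ∎)
      where open ≡-Reasoning
            pred-even : isEven (toℕ (predMod i)) ≡ true
            pred-even = trans (isEven-predMod n-even i) (cong not i-even)

alternating⇒isEven : ∀ {n} .{{_ : NonZero n}} (g : Fin n → Bool) →
                     (∀ i → g (sucMod n i) ≡ not (g i)) → isEven n ≡ true
alternating⇒isEven {suc n} g alternates = parity-fixed (isEven (suc n)) (g 0F) g₀-fixed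
  where
  along : ∀ m (m<n : m < suc n) → g (fromℕ< m<n) ≡ not (isEven m) xor g 0F
  along zero    _   = refl
  along (suc m) m<n = begin
    g (fromℕ< m<n)                             ≡⟨ cong g (sucMod-fromℕ< m m<n) ⟨
    g (sucMod (suc n) (fromℕ< _))              ≡⟨ alternates _ ⟩
    not (g (fromℕ< _))                         ≡⟨ cong not (along m (ℕ.<-trans (ℕ.n<1+n m) m<n)) ⟩
    not (not (isEven m) xor g 0F)              ≡⟨ not-distribˡ-xor (not (isEven m)) (g 0F) ⟩
    not (not (isEven m)) xor g 0F              ∎
    where open ≡-Reasoning
  last : Fin (suc n)
  last = fromℕ< (ℕ.n<1+n n)
  wraps : sucMod (suc n) last ≡ 0F
  wraps = Fin.toℕ-injective (toℕ-sucMod-last last (cong suc (Fin.toℕ-fromℕ< (ℕ.n<1+n n))))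
  g₀-fixed : g 0F ≡ not (isEven (suc n)) xor g 0F
  g₀-fixed = begin
    g 0F                              ≡⟨ cong g wraps ⟨
    g (sucMod (suc n) last)           ≡⟨ alternates last ⟩
    not (g last)                      ≡⟨ cong not (along n (ℕ.n<1+n n)) ⟩
    not (not (isEven n) xor g 0F)     ≡⟨ not-distribˡ-xor (not (isEven n)) (g 0F) ⟩
    not (isEven (suc n)) xor g 0F     ∎
    where open ≡-Reasoning
  parity-fixed : ∀ e x → x ≡ not e xor x → e ≡ true
  parity-fixed true  _ _  = refl
  parity-fixed false x eq = contradiction eq (not-¬ refl)

cycleMatching⇒isEven : ∀ {n} .{{_ : NonZero n}} → 3 ≤ n → (π : Fin n → Fin n) →
                       (∀ i → π (π i) ≡ i) → (∀ i → ∃[ c ] π i ≡ neighbour c i) → isEven n ≡ true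
cycleMatching⇒isEven {n} 2<n π π-involutive π-neighbour =
  alternating⇒isEven (λ i → proj₁ (π-neighbour i)) alternates
  where
  alternates : ∀ i → proj₁ (π-neighbour (sucMod n i)) ≡ not (proj₁ (π-neighbour i))
  alternates i with π-neighbour i | π-neighbour (sucMod n i)
  ... | true  , _  | false , _  = refl
  ... | false , _  | true  , _  = refl
  ... | true  , e₁ | true  , e₂ =
    contradiction (trans (sym e₂) (trans (cong π (sym e₁)) (π-involutive i))) (sucMod²≢id 2<n i)
  ... | false , e₁ | false , e₂ = contradiction (trans (sym e₁) πi≡i+1) (predMod≢sucMod 2<n i)
    where πi≡i+1 : π i ≡ sucMod n i
          πi≡i+1 = trans (cong π (sym (trans e₂ (predMod-sucMod i)))) (π-involutive (sucMod n i))

involution⇒perfectMatching : ∀ {V : Set} {G : Graph V} (f : V → V) →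
                             (∀ v → f (f v) ≡ v) → (∀ v → G v (f v)) → PerfectMatching G
involution⇒perfectMatching {G = G} f f-involutive f-adjacent = record
  { E       = λ u v → v ≡ f u
  ; E-sym   = λ {u} e → trans (sym (f-involutive u)) (cong f (sym e))
  ; E-edge  = λ {u} e → subst (G u) (sym e) (f-adjacent u)
  ; partner = f
  ; covers  = λ _ → refl
  ; unique  = λ e → e
  }

module _ {V : Set} {G : Graph V} (M : PerfectMatching G) where

  partner-sym : ∀ {v w} → w ≡ partner M v → v ≡ partner M w
  partner-sym {v} refl = unique M (E-sym M (covers M v))

  partner-involutive : ∀ v → partner M (partner M v) ≡ v
  partner-involutive v = sym (partner-sym refl)

module HamiltonianUnion {V : Set} {G : Graph V} (M N : PerfectMatching G) (H : HamCycle G)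
                        (M∪N≡H : ∀ u v → (E M u v ⊎ E N u v) ⇔ HamCycle.Edge H u v) where
  open HamCycle H

  from : V → Fin k
  from = Inverse.from c

  to-from : ∀ v → to (from v) ≡ v
  to-from = Inverse.strictlyInverseˡ c

  from-to : ∀ i → from (to i) ≡ i
  from-to = Inverse.strictlyInverseʳ c

  to-injective : ∀ {i j} → to i ≡ to j → i ≡ j
  to-injective {i} {j} e = trans (sym (from-to i)) (trans (cong from e) (from-to j))

  PartnerOf : V → V → Set
  PartnerOf v w = w ≡ partner M v ⊎ w ≡ partner N v

  PartnerOf-sym : ∀ {v w} → PartnerOf v w → PartnerOf w v
  PartnerOf-sym (inj₁ e) = inj₁ (partner-sym M e)
  PartnerOf-sym (inj₂ e) = inj₂ (partner-sym N e)

  next : ∀ i → PartnerOf (to i) (to (sucMod k i))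
  next i with Equivalence.from (M∪N≡H _ _) (i , inj₁ (refl , refl))
  ... | inj₁ e = inj₁ (unique M e)
  ... | inj₂ e = inj₂ (unique N e)

  prev : ∀ i → PartnerOf (to i) (to (predMod i))
  prev i = subst (λ j → PartnerOf (to j) (to (predMod i))) (sucMod-predMod i) (PartnerOf-sym (next (predMod i)))

  partners-differ : ∀ v → partner M v ≢ partner N v
  partners-differ v Mv≡Nv = predMod≢sucMod k≥3 j (to-injective (trans (collapse (prev j)) (sym (collapse (next j)))))
    where
    j : Fin k
    j = from v
    collapse : ∀ {w} → PartnerOf (to j) w → w ≡ partner M v
    collapse (inj₁ e) = trans e (cong (partner M) (to-from v))
    collapse (inj₂ e) = trans e (trans (cong (partner N) (to-from v)) (sym Mv≡Nv))

  M-matches-cycle-neighbours : ∀ i → ∃[ c ] from (partner M (to i)) ≡ neighbour c i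
  M-matches-cycle-neighbours i with next i | prev i
  ... | inj₁ e  | _      = true  , trans (cong from (sym e)) (from-to _)
  ... | inj₂ _  | inj₁ e = false , trans (cong from (sym e)) (from-to _)
  ... | inj₂ e₁ | inj₂ e₂ = contradiction (to-injective (trans e₂ (sym e₁))) (predMod≢sucMod k≥3 i)

  isEven-length : isEven k ≡ true
  isEven-length = cycleMatching⇒isEven k≥3 (λ i → from (partner M (to i))) M-involutive M-matches-cycle-neighbours
    where
    M-involutive : ∀ i → from (partner M (to (from (partner M (to i))))) ≡ i
    M-involutive i = trans (cong (λ v → from (partner M v)) (to-from _))
                           (trans (cong from (partner-involutive M (to i))) (from-to i))

  closed⇒everywhere : (T : V → Set) → (∀ v → T v → T (partner M v)) → (∀ v → T v → T (partner N v)) →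
                      ∀ u v → T u → T v
  closed⇒everywhere T closedᴹ closedᴺ u v tu = subst T (to-from v)
    (cyclic-transport (λ i → T (to i)) forward backward (from u) (from v) (subst T (sym (to-from u)) tu))
    where
    closed : ∀ {v w} → PartnerOf v w → T v → T w
    closed (inj₁ e) t = subst T (sym e) (closedᴹ _ t)
    closed (inj₂ e) t = subst T (sym e) (closedᴺ _ t)
    forward : ∀ i → T (to i) → T (to (sucMod k i))
    forward i = closed (next i)
    backward : ∀ i → T (to (sucMod k i)) → T (to i)
    backward i t = subst (λ j → T (to j)) (predMod-sucMod i) (closed (prev (sucMod k i)) t)

PMH⇒isEven-order : ∀ {V : Set} {G : Graph V} {m} → V ↔ Fin m → PMH G → isEven m ≡ true
PMH⇒isEven-order V↔m (M , extendable) with extendable M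
... | N , H , M∪N≡H =
  subst (λ k → isEven k ≡ true) (↔⇒≡ (↔-trans (HamCycle.c H) V↔m)) isEven-length
  where open HamiltonianUnion M N H M∪N≡H using (isEven-length)

rowZero-neighbours : ∀ {p q} .{{_ : NonZero p}} {a : Fin p} {v : Fin p × Fin (2 + q)} →
                     CpPq p (2 + q) (a , 0F) v → v ≡ (a , 1F) ⊎ ∃[ c ] v ≡ (neighbour c a , 0F)
rowZero-neighbours {v = a , b} (inj₁ (refl , inj₁ b≡1)) = inj₁ (cong (a ,_) (Fin.toℕ-injective b≡1))
rowZero-neighbours (inj₁ (refl , inj₂ ()))
rowZero-neighbours (inj₂ (inj₁ refl , refl)) = inj₂ (true , refl)
rowZero-neighbours {v = a′ , _} (inj₂ (inj₂ a≡a′+1 , refl)) =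
  inj₂ (false , cong (_, 0F) (trans (sym (predMod-sucMod a′)) (cong predMod (sym a≡a′+1))))

module EvenCycle (p q : ℕ) .{{_ : NonZero p}} (p-even : isEven p ≡ true) where

  Vertex : Set
  Vertex = Fin p × Fin (3 + q)

  shifted : Fin (3 + q) → Bool
  shifted 1F = true
  shifted _  = false

  staggered : Vertex → Vertex
  staggered (a , b) = (pairing (shifted b) a , b)

  Staggered : PerfectMatching (CpPq p (3 + q))
  Staggered = involution⇒perfectMatching staggered
    (λ (a , b) → cong (_, b) (pairing-involutive p-even (shifted b) a))
    (λ (a , b) → inj₂ (neighbour-adjacent (shifted b xor isEven (toℕ a)) a , refl))

  not-extendable : ¬ Extendable (CpPq p (3 + q)) Staggered
  not-extendable (N , H , M∪N≡H) = closed⇒everywhere Reached closedᴹ closedᴺ (a₀ , 0F) (a₀ , 2F) tt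
    where
    open HamiltonianUnion Staggered N H M∪N≡H using (closed⇒everywhere; partners-differ)
    n : Vertex → Vertex
    n = partner N
    a₀ : Fin p
    a₀ = fromℕ< (>-nonZero⁻¹ p)

    Reached : Vertex → Set
    Reached (a , 0F)                   = ⊤
    Reached (a , 1F)                   = n (a , 1F) ≡ (a , 0F)
    Reached (a , Fin.suc (Fin.suc _)) = ⊥

    closedᴺ : ∀ v → Reached v → Reached (n v)
    closedᴺ (a , 0F) _ with rowZero-neighbours (E-edge N (covers N (a , 0F)))
    ... | inj₁ e       = subst Reached (sym e) (trans (cong n (sym e)) (partner-involutive N _))
    ... | inj₂ (_ , e) = subst Reached (sym e) tt
    closedᴺ (a , 1F) e = subst Reached (sym e) tt

    -- The N-partner of (a′ , 0) can be neither its Staggered partner nor (a , 0), which N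
    -- already matches to (a , 1); so it is (a′ , 1).
    closedᴹ : ∀ v → Reached v → Reached (staggered v)
    closedᴹ (a , 0F) _ = tt
    closedᴹ (a , 1F) e = trans (cong n (sym below)) (partner-involutive N _)
      where
      a′ : Fin p
      a′ = pairing true a
      below : n (a′ , 0F) ≡ (a′ , 1F)
      below with rowZero-neighbours (E-edge N (covers N (a′ , 0F)))
      ... | inj₁ e′ = e′
      ... | inj₂ (c , e′) with neighbour-is-pairing c a′
      ... | false , e″ = contradiction (sym (trans e′ (cong (_, 0F) e″))) (partners-differ (a′ , 0F))
      ... | true  , e″ = contradiction (cong proj₂ (begin
        (a′ , 0F)       ≡⟨ partner-involutive N _ ⟨
        n (n (a′ , 0F)) ≡⟨ cong n (trans e′ (cong (_, 0F) (trans e″ (pairing-involutive p-even true a)))) ⟩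
        n (a , 0F)      ≡⟨ cong n e ⟨
        n (n (a , 1F))  ≡⟨ partner-involutive N _ ⟩
        (a , 1F)        ∎)) λ ()
        where open ≡-Reasoning

module VerticalMatching (p q : ℕ) .{{_ : NonZero p}} (2<p : 3 ≤ p) (q-even : isEven (2 + q) ≡ true) where

  Vertex : Set
  Vertex = Fin p × Fin (2 + q)

  vertical : Vertex → Vertex
  vertical (a , b) = (a , pairing false b)

  Vertical : PerfectMatching (CpPq p (2 + q))
  Vertical = involution⇒perfectMatching vertical
    (λ (a , b) → cong (a ,_) (pairing-involutive q-even false b))
    (λ (a , b) → inj₁ (refl , toℕ-pairing-false q-even b))

  extendable⇒isEven : Extendable (CpPq p (2 + q)) Vertical → isEven p ≡ true
  extendable⇒isEven (N , H , M∪N≡H) =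
    cycleMatching⇒isEven 2<p π π-involutive (λ a → proj₁ (horizontal a) , refl)
    where
    open HamiltonianUnion Vertical N H M∪N≡H using (partners-differ)
    n : Vertex → Vertex
    n = partner N

    horizontal : ∀ a → ∃[ c ] n (a , 0F) ≡ (neighbour c a , 0F)
    horizontal a with rowZero-neighbours (E-edge N (covers N (a , 0F)))
    ... | inj₁ e = contradiction (sym e) (partners-differ (a , 0F))
    ... | inj₂ h = h

    π : Fin p → Fin p
    π a = neighbour (proj₁ (horizontal a)) a

    π-involutive : ∀ a → π (π a) ≡ a
    π-involutive a = cong proj₁ (begin
      (π (π a) , 0F) ≡⟨ proj₂ (horizontal (π a)) ⟨
      n (π a , 0F)   ≡⟨ cong n (proj₂ (horizontal a)) ⟨
      n (n (a , 0F)) ≡⟨ partner-involutive N _ ⟩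
      (a , 0F)       ∎)
      where open ≡-Reasoning

lemma1 : (p q : ℕ) → 3 ≤ p → 3 ≤ q → .{{_ : NonZero p}} → ¬ PMH (CpPq p q)
lemma1 p (suc (suc (suc q))) 2<p (s≤s (s≤s (s≤s _))) pmh@(_ , extendable)
  with isEven p in p-parity | isEven (3 + q) in q-parity
... | true  | _     = EvenCycle.not-extendable p q p-parity (extendable (EvenCycle.Staggered p q p-parity))
... | false | true  = contradiction (trans (sym p-parity) (extendable⇒isEven (extendable Vertical))) λ ()
  where open VerticalMatching p (suc q) 2<p q-parity
... | false | false = contradiction (begin
  false                      ≡⟨ cong₂ _∨_ p-parity q-parity ⟨
  isEven p ∨ isEven (3 + q)  ≡⟨ isEven-* p (3 + q) ⟨
  isEven (p * (3 + q))       ≡⟨ PMH⇒isEven-order (↔-sym Fin.*↔×) pmh ⟩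
  true                       ∎) λ ()
  where open ≡-Reasoning
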